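{- There is a computable translation which maps every $\mathrm{LRP}^2$ formula $\phi$ over a vocabulary $\tau$ to a finite disjunction of $\mathrm{NLRP}^2$ formulas over a vocabulary $\tau'$ obtained from $\tau$ by adding new constant symbols, such that $\phi$ is satisfiable if and only if the resulting disjunction is satisfiable.
   Context: A vocabulary is $\tau=\langle C,U,F\rangle$, where $C$ is a finite set of constant symbols, $U$ a set of unary relation symbols and $F$ a finite set of binary relation symbols (edge labels). A graph (interpretation) over $\tau$ is $G=\langle V,E,C^G,U^G\rangle$ with $V$ a set of nodes, $E(f)\subseteq V\times V$ for $f\in F$, $C^G(c)\in V$ for $c\in C$, and $U^G(u)\subseteq V$ for $u\in U$. Terms are variables or constants; atomic formulas are $t=t'$, $u(t)$ and $t\xrightarrow{f}t'$ (meaning $(t,t')\in E(f)$); quantifier-free formulas are Boolean combinations of atomic formulas. Routing expressions are given by the grammar $R::=\emptyset\mid\epsilon\mid \xrightarrow{f}\mid \xleftarrow{f}\mid u\mid\neg u\mid c\mid \neg c\mid R_1.R_2\mid R_1|R_2\mid R^*$ ($f\in F,u\in U,c\in C$), denoting a language $L(R)$ of words over the letters $\xrightarrow{f},\xleftarrow{f},u,\neg u,c,\neg c$. A path labelled by a word $w$ from node $a$ to node $b$ is defined by: $\epsilon$: $a=b$; $\xrightarrow{f}$: $(a,b)\in E(f)$; $\xleftarrow{f}$: $(b,a)\in E(f)$; $u$: $a=b\in U^G(u)$; $\neg u$: $a=b\notin U^G(u)$; $c$: $a=b=C^G(c)$; $\neg c$: $a=b\neq C^G(c)$; and a word $w_1w_2$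 labels a path from $a$ to $b$ iff there is a node $d$ with a $w_1$-path from $a$ to $d$ and a $w_2$-path from $d$ to $b$. An $R$-path is a path labelled by some word of $L(R)$. A neighborhood formula $N(v_0,\dots,v_n)$ is a conjunction of edge atoms $v_i\xrightarrow{f}v_j$. A reachability constraint, written $[c,R]p$, is a closed formula $\forall v_0,\dots,v_n.\ R(c,v_0)\Rightarrow(N(v_0,\dots,v_n)\Rightarrow\psi(v_0,\dots,v_n))$ where $c\in C$, $R$ is a routing expression, $N$ is a neighborhood formula, $\psi$ is quantifier-free, the free variables of $N$ are among $v_0,\dots,v_n$ and those of $\psi$ are among $FV(N)\cup\{v_0\}$; $p(v_0):=N\Rightarrow\psi$ is its pattern. A graph $G$ satisfies it iff for every node $a$ reachable by an $R$-path from $C^G(c)$ and every assignment of nodes to $v_0,\dots,v_n$ with $v_0\mapsto a$, the assignment satisfies $N\Rightarrow\psi$. An $\mathrm{LRP}$ formula is a Boolean combination of reachability constraints. For $c_1,c_2\in C$, $\langle c_1,R\rangle c_2$ denotes the negation of the reachability constraint $[c_1,R]p$ with $p(v_0):=\mathit{true}\Rightarrow\neg(v_0=c_2)$; it states that there is an $R$-path from $C^G(c_1)$ to $C^G(c_2)$. The Gaifman graph $B_N$ of a neighborhood formula $N$ is the undirected graph on its free variables with an arc between $v_i$ and $v_j$ iff some atom $v_i\xrightarrow{f}v_j$ occurs in $N$; the distance between two variables in $N$ is their edge distance in $B_N$. A pattern $N\Rightarrow\psi$ is $\mathrm{LRP}^2$-admissible if $\psi$ is either (equality pattern) $v_i=v_j$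 with distance between $v_i,v_j$ in $N$ at most $2$, or (edge pattern) $v_i\xrightarrow{f}v_j$ with distance between $v_i,v_j$ in $N$ at most $1$, or (negative pattern) a quantifier-free formula in which atomic formulas occur only negatively. An $\mathrm{LRP}$ formula is in $\mathrm{LRP}^2$ if all patterns of its reachability constraints are $\mathrm{LRP}^2$-admissible. An $\mathrm{NLRP}^2$ formula is a conjunction of formulas each of the form $\langle c_1,R\rangle c_2$ or $[c,R]p$ with $p$ an $\mathrm{LRP}^2$-admissible pattern. -}

module Defs where

open import Level using (Level; 0ℓ) renaming (suc to lsuc)
open import Data.Nat using (ℕ; zero; suc; _+_)
open import Data.Fin using (Fin; zero; suc; inject+)
open import Data.List using (List; []; _∷_; _++_)
open import Data.List.Relation.Unary.All using (All)
open import Data.List.Relation.Unary.Any using (Any)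
open import Data.List.Membership.Propositional using (_∈_)
open import Data.Product using (Σ; ∃; _×_; _,_)
open import Data.Sum using (_⊎_; inj₂)
open import Data.Unit using (⊤)
open import Data.Empty using (⊥)
open import Relation.Nullary using (¬_)
open import Relation.Binary.PropositionalEquality using (_≡_; refl)

-- Vocabularies  τ = ⟨C , U , F⟩
-- C = Fin nC (finite constants), U an arbitrary set, F = Fin nF (finite).

record Vocab : Set₁ where
  constructor vocab
  field
    nC : ℕ
    U  : Set
    nF : ℕ

open Vocab public

-- τ' : τ extended by k new constant symbols (old constant c ↦ inject+ k c)
extend : Vocab → ℕ → Vocab
extend τ k = vocab (nC τ + k) (U τ) (nF τ)

record Graph (τ : Vocab) : Set₁ where
  field
    V  : Set
    E  : Fin (nF τ) → V → V → Set
    CG : Fin (nC τ) → V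
    UG : U τ → V → Set

open Graph public

-- Terms and quantifier-free formulas over variables v₀ … vₙ (Fin (suc n))

module _ (τ : Vocab) where

  data Term (n : ℕ) : Set where
    var   : Fin (suc n) → Term n
    const : Fin (nC τ) → Term n

  data Atom (n : ℕ) : Set where
    _≐_    : Term n → Term n → Atom n
    un     : U τ → Term n → Atom n
    edge   : Term n → Fin (nF τ) → Term n → Atom n

  data QF (n : ℕ) : Set where
    atom  : Atom n → QF n
    tt ff : QF n
    ¬'_   : QF n → QF n
    _∧'_  : QF n → QF n → QF n
    _∨'_  : QF n → QF n → QF n
    _⇒'_  : QF n → QF n → QF n

  -- neighborhood formula: conjunction of edge atoms  v_i --f--> v_j
  record EdgeAtom (n : ℕ) : Set where
    constructor _─[_]→_
    field
      src : Fin (suc n)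
      lab : Fin (nF τ)
      tgt : Fin (suc n)

  Nbhd : ℕ → Set
  Nbhd n = List (EdgeAtom n)

  FreeIn : ∀ {n} → Fin (suc n) → Nbhd n → Set
  FreeIn i N = Any (λ a → EdgeAtom.src a ≡ i ⊎ EdgeAtom.tgt a ≡ i) N

  VarsT : ∀ {n} → (Fin (suc n) → Set) → Term n → Set
  VarsT P (var i)   = P i
  VarsT P (const c) = ⊤

  VarsA : ∀ {n} → (Fin (suc n) → Set) → Atom n → Set
  VarsA P (t ≐ t')      = VarsT P t × VarsT P t'
  VarsA P (un u t)      = VarsT P t
  VarsA P (edge t f t') = VarsT P t × VarsT P t'

  VarsQ : ∀ {n} → (Fin (suc n) → Set) → QF n → Set
  VarsQ P (atom a)  = VarsA P a
  VarsQ P tt        = ⊤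
  VarsQ P ff        = ⊤
  VarsQ P (¬' φ)    = VarsQ P φ
  VarsQ P (φ ∧' ψ)  = VarsQ P φ × VarsQ P ψ
  VarsQ P (φ ∨' ψ)  = VarsQ P φ × VarsQ P ψ
  VarsQ P (φ ⇒' ψ)  = VarsQ P φ × VarsQ P ψ

  record Pattern : Set where
    constructor mkPat
    field
      n   : ℕ
      N   : Nbhd n
      ψ   : QF n
      wf  : VarsQ (λ i → FreeIn i N ⊎ i ≡ zero) ψ

  data Letter : Set where
    fwd bwd   : Fin (nF τ) → Letter
    pos neg   : U τ → Letter
    posc negc : Fin (nC τ) → Letter

  Word : Set
  Word = List Letter

  data Routing : Set where
    ∅ ε          : Routing
    ⟶ ⟵         : Fin (nF τ) → Routing
    `u `¬u       : U τ → Routing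
    `c `¬c       : Fin (nC τ) → Routing
    _·_ _∣_      : Routing → Routing → Routing
    _*           : Routing → Routing

  data _∈L_ : Word → Routing → Set where
    ε∈    : [] ∈L ε
    fwd∈  : ∀ {f} → (fwd f ∷ []) ∈L ⟶ f
    bwd∈  : ∀ {f} → (bwd f ∷ []) ∈L ⟵ f
    pos∈  : ∀ {u} → (pos u ∷ []) ∈L `u u
    neg∈  : ∀ {u} → (neg u ∷ []) ∈L `¬u u
    posc∈ : ∀ {c} → (posc c ∷ []) ∈L `c c
    negc∈ : ∀ {c} → (negc c ∷ []) ∈L `¬c c
    ·∈    : ∀ {R₁ R₂ w₁ w₂} → w₁ ∈L R₁ → w₂ ∈L R₂ → (w₁ ++ w₂) ∈L (R₁ · R₂)
    ∣∈₁   : ∀ {R₁ R₂ w} → w ∈L R₁ → w ∈L (R₁ ∣ R₂)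
    ∣∈₂   : ∀ {R₁ R₂ w} → w ∈L R₂ → w ∈L (R₁ ∣ R₂)
    *∈[]  : ∀ {R} → [] ∈L (R *)
    *∈++  : ∀ {R w₁ w₂} → w₁ ∈L R → w₂ ∈L (R *) → (w₁ ++ w₂) ∈L (R *)

  record RC : Set where
    constructor [_,_]_
    field
      c : Fin (nC τ)
      R : Routing
      p : Pattern

  data LRP : Set where
    rc        : RC → LRP
    tt ff     : LRP
    ¬'_       : LRP → LRP
    _∧'_ _∨'_ : LRP → LRP → LRP

  Dist≤1 : ∀ {n} → Nbhd n → Fin (suc n) → Fin (suc n) → Set
  Dist≤1 N i j = i ≡ j ⊎ ∃ (λ f → (i ─[ f ]→ j) ∈ N ⊎ (j ─[ f ]→ i) ∈ N)

  Dist≤2 : ∀ {n} → Nbhd n → Fin (suc n) → Fin (suc n) → Set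
  Dist≤2 N i j = ∃ (λ k → Dist≤1 N i k × Dist≤1 N k j)

  OnlyPos OnlyNeg : ∀ {n} → QF n → Set
  OnlyPos (atom a)  = ⊤
  OnlyPos tt        = ⊤
  OnlyPos ff        = ⊤
  OnlyPos (¬' φ)    = OnlyNeg φ
  OnlyPos (φ ∧' ψ)  = OnlyPos φ × OnlyPos ψ
  OnlyPos (φ ∨' ψ)  = OnlyPos φ × OnlyPos ψ
  OnlyPos (φ ⇒' ψ)  = OnlyNeg φ × OnlyPos ψ
  OnlyNeg (atom a)  = ⊥
  OnlyNeg tt        = ⊤
  OnlyNeg ff        = ⊤
  OnlyNeg (¬' φ)    = OnlyPos φ
  OnlyNeg (φ ∧' ψ)  = OnlyNeg φ × OnlyNeg ψ
  OnlyNeg (φ ∨' ψ)  = OnlyNeg φ × OnlyNeg ψ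
  OnlyNeg (φ ⇒' ψ)  = OnlyPos φ × OnlyNeg ψ

  data Admissible : Pattern → Set where
    eqPat  : ∀ {n N i j wf} → Dist≤2 N i j →
             Admissible (mkPat n N (atom (var i ≐ var j)) wf)
    edgePat : ∀ {n N i f j wf} → Dist≤1 N i j →
             Admissible (mkPat n N (atom (edge (var i) f (var j))) wf)
    negPat : ∀ {n N ψ wf} → OnlyNeg ψ → Admissible (mkPat n N ψ wf)

  AllAdm : LRP → Set
  AllAdm (rc (([ c , R ] p))) = Admissible p
  AllAdm tt       = ⊤
  AllAdm ff       = ⊤
  AllAdm (¬' φ)   = AllAdm φ
  AllAdm (φ ∧' ψ) = AllAdm φ × AllAdm ψ
  AllAdm (φ ∨' ψ) = AllAdm φ × AllAdm ψ

  LRP² : Set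
  LRP² = Σ LRP AllAdm

  notEqPat : Fin (nC τ) → Pattern
  notEqPat c₂ = mkPat 0 [] (tt ⇒' (¬' atom (var zero ≐ const c₂))) (_ , (inj₂ refl , _))

  data NConj : Set where
    ⟨_,_⟩_  : Fin (nC τ) → Routing → Fin (nC τ) → NConj
    box     : (r : RC) → Admissible (RC.p r) → NConj

  NLRP² : Set
  NLRP² = List NConj

module _ {τ : Vocab} (G : Graph τ) where

  ⟦_⟧T : ∀ {n} → Term τ n → (Fin (suc n) → V G) → V G
  ⟦ var i ⟧T ρ   = ρ i
  ⟦ const c ⟧T ρ = CG G c

  ⟦_⟧A : ∀ {n} → Atom τ n → (Fin (suc n) → V G) → Set
  ⟦ t ≐ t' ⟧A ρ      = ⟦ t ⟧T ρ ≡ ⟦ t' ⟧T ρ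
  ⟦ un u t ⟧A ρ      = UG G u (⟦ t ⟧T ρ)
  ⟦ edge t f t' ⟧A ρ = E G f (⟦ t ⟧T ρ) (⟦ t' ⟧T ρ)

  ⟦_⟧Q : ∀ {n} → QF τ n → (Fin (suc n) → V G) → Set
  ⟦ atom a ⟧Q ρ  = ⟦ a ⟧A ρ
  ⟦ tt ⟧Q ρ      = ⊤
  ⟦ ff ⟧Q ρ      = ⊥
  ⟦ ¬' φ ⟧Q ρ    = ¬ ⟦ φ ⟧Q ρ
  ⟦ φ ∧' ψ ⟧Q ρ  = ⟦ φ ⟧Q ρ × ⟦ ψ ⟧Q ρ
  ⟦ φ ∨' ψ ⟧Q ρ  = ⟦ φ ⟧Q ρ ⊎ ⟦ ψ ⟧Q ρ
  ⟦ φ ⇒' ψ ⟧Q ρ  = ⟦ φ ⟧Q ρ → ⟦ ψ ⟧Q ρ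

  ⟦_⟧N : ∀ {n} → Nbhd τ n → (Fin (suc n) → V G) → Set
  ⟦ N ⟧N ρ = All (λ a → E G (EdgeAtom.lab a) (ρ (EdgeAtom.src a)) (ρ (EdgeAtom.tgt a))) N

  Step : Letter τ → V G → V G → Set
  Step (fwd f)  a b = E G f a b
  Step (bwd f)  a b = E G f b a
  Step (pos u)  a b = a ≡ b × UG G u a
  Step (neg u)  a b = a ≡ b × ¬ UG G u a
  Step (posc c) a b = a ≡ b × a ≡ CG G c
  Step (negc c) a b = a ≡ b × ¬ (a ≡ CG G c)

  PathW : Word τ → V G → V G → Set
  PathW []      a b = a ≡ b
  PathW (l ∷ w) a b = Σ (V G) (λ d → Step l a d × PathW w d b)

  RPath : Routing τ → V G → V G → Set
  RPath R a b = Σ (Word τ) (λ w → (_∈L_ τ w R) × PathW w a b)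

  _⊨RC_ : RC τ → Set
  _⊨RC_ ([ c , R ] mkPat n N ψ _) =
    (ρ : Fin (suc n) → V G) → RPath R (CG G c) (ρ zero) → ⟦ N ⟧N ρ → ⟦ ψ ⟧Q ρ

  _⊨_ : LRP τ → Set
  _⊨_ (rc r)   = _⊨RC_ r
  _⊨_ tt       = ⊤
  _⊨_ ff       = ⊥
  _⊨_ (¬' φ)   = ¬ (_⊨_ φ)
  _⊨_ (φ ∧' ψ) = _⊨_ φ × _⊨_ ψ
  _⊨_ (φ ∨' ψ) = _⊨_ φ ⊎ _⊨_ ψ

  _⊨C_ : NConj τ → Set
  _⊨C_ (⟨ c₁ , R ⟩ c₂) = ¬ (_⊨RC_ ([ c₁ , R ] notEqPat τ c₂))
  _⊨C_ (box r _)       = _⊨RC_ r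

  _⊨N_ : NLRP² τ → Set
  _⊨N_ φs = All _⊨C_ φs

SatLRP² : {τ : Vocab} → LRP² τ → Set₁
SatLRP² {τ} (φ , _) = Σ (Graph τ) (λ G → G ⊨ φ)

SatDisj : {τ : Vocab} → List (NLRP² τ) → Set₁
SatDisj {τ} ds = Σ (Graph τ) (λ G → Any (λ φ → G ⊨N φ) ds)

-- A positive occurrence of a constraint [c , R] p is already an NLRP² conjunct, because p is
-- admissible. A negative occurrence ¬ [c , R] (N ⇒ ψ) asserts nodes v₀ … vₙ reached from c by an
-- R-path, satisfying N and ¬ ψ; naming them by fresh constants d₀ … dₙ turns the path and the edges
-- of N into ⟨c , R⟩ d₀ and ⟨dᵢ , →f⟩ dⱼ, and ¬ ψ, in disjunctive normal form, into a disjunction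
-- of conjunctions of literals between constants: a positive literal is ⟨s , ε⟩ t, ⟨s , u⟩ s or
-- ⟨s , →f⟩ t, a negative one a negative pattern with empty neighbourhood. Distributing ∧ over ∨
-- through the Boolean structure of the formula gives the disjunction. A model of it restricts to a
-- model of the formula; conversely a model of the formula is expanded by interpreting each fresh
-- constant as the corresponding witness of a violated constraint. Excluded middle is needed to
-- extract these witnesses and because ⟨c₁ , R⟩ c₂ is defined as a double negation.
module Submission where

open import Defs
open import Level using (0ℓ; lift; lower)
import Level
open import Data.Bool using (Bool; true; false)
open import Data.Nat using (ℕ; suc; _+_)
open import Data.Fin using (Fin; zero; _↑ˡ_; _↑ʳ_)
open import Data.Vec.Functional using (take; drop) renaming (_++_ to _++ᵛ_)
open import Data.Vec.Functional.Properties using (lookup-++ˡ; lookup-++ʳ)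
open import Data.List using (List; []; _∷_; _++_; map; cartesianProductWith)
open import Data.List.Properties using (map-++)
open import Data.List.Relation.Unary.All as All using (All; []; _∷_)
import Data.List.Relation.Unary.All.Properties as AllP
open import Data.List.Relation.Unary.Any as Any using (Any; here)
import Data.List.Relation.Unary.Any.Properties as AnyP
open import Data.List.Membership.Propositional.Properties using (∈-map⁺)
open import Data.Product using (Σ; ∃; _×_; _,_; proj₂)
import Data.Product as Product
open import Data.Sum using (_⊎_; inj₁; inj₂)
import Data.Sum as Sum
open import Data.Unit using (tt)
open import Data.Empty using (⊥-elim)
open import Function using (_∘_; id)
open import Function.Bundles using (_⇔_; mk⇔; Equivalence)
open import Function.Properties.Equivalence using () renaming (refl to ⇔-refl; trans to ⇔-trans)
open import Relation.Nullary using (¬_; yes; no)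
open import Relation.Nullary.Decidable using (map′)
open import Relation.Binary.PropositionalEquality using (_≡_; _≗_; refl; sym; trans; cong; cong₂; subst)
open import Axiom.ExcludedMiddle using (ExcludedMiddle)
open import Axiom.DoubleNegationElimination using (DoubleNegationElimination; em⇒dne)

open Equivalence using (to; from)

_[nC≔_] : Vocab → ℕ → Vocab
τ [nC≔ m ] = vocab m (U τ) (nF τ)

_[CG≔_] : ∀ {τ m} (G : Graph τ) → (Fin m → V G) → Graph (τ [nC≔ m ])
G [CG≔ C ] = record { V = V G ; E = E G ; CG = C ; UG = UG G }

Signed : Bool → Set → Set
Signed true  A = A
Signed false A = ¬ A

≡⇒⇔ : {A B : Set} → A ≡ B → A ⇔ B
≡⇒⇔ refl = ⇔-refl

module Classical (em : ExcludedMiddle (Level.suc 0ℓ)) where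

  em₀ : ExcludedMiddle 0ℓ
  em₀ {P} = map′ lower lift (em {Level.Lift _ P})

  dne : DoubleNegationElimination 0ℓ
  dne = em⇒dne em₀

  ¬×⇒¬⊎¬ : {P Q : Set} → ¬ (P × Q) → ¬ P ⊎ ¬ Q
  ¬×⇒¬⊎¬ {P} ¬pq with em₀ {P}
  ... | yes p = inj₂ (λ q → ¬pq (p , q))
  ... | no ¬p = inj₁ ¬p

  ¬→⇒×¬ : {P Q : Set} → ¬ (P → Q) → P × ¬ Q
  ¬→⇒×¬ ¬pq = dne (λ ¬p → ¬pq (⊥-elim ∘ ¬p)) , (λ q → ¬pq (λ _ → q))

  ¬∀⇒∃¬ : {X : Set} {P : X → Set} → ¬ (∀ x → P x) → ∃ λ x → ¬ P x
  ¬∀⇒∃¬ ¬∀ = dne (λ ¬∃ → ¬∀ (λ x → dne (λ ¬px → ¬∃ (x , ¬px))))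

module _ {τ : Vocab} (G : Graph τ) where

  RPath-ε : ∀ {a b} → RPath G ε a b ⇔ a ≡ b
  RPath-ε = mk⇔ (λ { (_ , ε∈ , a≡b) → a≡b }) (λ a≡b → [] , ε∈ , a≡b)

  RPath-⟶ : ∀ {f a b} → RPath G (⟶ f) a b ⇔ E G f a b
  RPath-⟶ {f} = mk⇔
    (λ { (_ , fwd∈ , (_ , e , refl)) → e })
    (λ e → fwd f ∷ [] , fwd∈ , (_ , e , refl))

  RPath-`u : ∀ {u a} → RPath G (`u u) a a ⇔ UG G u a
  RPath-`u {u} = mk⇔
    (λ { (_ , pos∈ , (_ , (_ , ua) , _)) → ua })
    (λ ua → pos u ∷ [] , pos∈ , (_ , (refl , ua) , refl))

  ⊨⟨⟩⇔¬¬RPath : ∀ {a R b} → G ⊨C (⟨ a , R ⟩ b) ⇔ (¬ ¬ RPath G R (CG G a) (CG G b))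
  ⊨⟨⟩⇔¬¬RPath {a} {R} {b} = mk⇔
    (λ ¬⊨ ¬path → ¬⊨ (λ ρ path _ _ ρ₀≡b → ¬path (subst (RPath G R (CG G a)) ρ₀≡b path)))
    (λ ¬¬path ⊨ → ¬¬path (λ path → ⊨ (λ _ → CG G b) path [] tt refl))

  Violation : Fin (nC τ) → Routing τ → ∀ {n} → Nbhd τ n → QF τ n → (Fin (suc n) → V G) → Set
  Violation c R N ψ ρ = RPath G R (CG G c) (ρ zero) × ⟦_⟧N G N ρ × ¬ ⟦_⟧Q G ψ ρ

  violation⇒¬⊨RC : ∀ {c R n} N ψ wf {ρ} → Violation c R N ψ ρ → ¬ G ⊨RC ([ c , R ] mkPat n N ψ wf)
  violation⇒¬⊨RC _ _ _ {ρ} (path , nb , ¬ψ) ⊨ = ¬ψ (⊨ ρ path nb)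

module _ (em : ExcludedMiddle (Level.suc 0ℓ)) {τ : Vocab} (G : Graph τ) where
  open Classical em

  ⊨⟨⟩⇔RPath : ∀ {a R b} → G ⊨C (⟨ a , R ⟩ b) ⇔ RPath G R (CG G a) (CG G b)
  ⊨⟨⟩⇔RPath = ⇔-trans (⊨⟨⟩⇔¬¬RPath G) (mk⇔ dne (λ path ¬path → ¬path path))

  ¬⊨RC⇒violation : ∀ {c R n} N ψ wf → ¬ G ⊨RC ([ c , R ] mkPat n N ψ wf) → ∃ (Violation G c R N ψ)
  ¬⊨RC⇒violation _ _ _ ¬⊨ =
    let ρ , ¬⊨ρ     = ¬∀⇒∃¬ ¬⊨
        path , ¬⊨ρ′ = ¬→⇒×¬ ¬⊨ρ
        nb , ¬ψ     = ¬→⇒×¬ ¬⊨ρ′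
    in ρ , path , nb , ¬ψ

module Renaming {τ : Vocab} {m : ℕ} (σ : Fin (nC τ) → Fin m) where

  private
    τ′ = τ [nC≔ m ]

  renameL : Letter τ → Letter τ′
  renameL (fwd f)  = fwd f
  renameL (bwd f)  = bwd f
  renameL (pos u)  = pos u
  renameL (neg u)  = neg u
  renameL (posc c) = posc (σ c)
  renameL (negc c) = negc (σ c)

  renameR : Routing τ → Routing τ′
  renameR ∅         = ∅
  renameR ε         = ε
  renameR (⟶ f)     = ⟶ f
  renameR (⟵ f)     = ⟵ f
  renameR (`u u)    = `u u
  renameR (`¬u u)   = `¬u u
  renameR (`c c)    = `c (σ c)
  renameR (`¬c c)   = `¬c (σ c)
  renameR (R₁ · R₂) = renameR R₁ · renameR R₂
  renameR (R₁ ∣ R₂) = renameR R₁ ∣ renameR R₂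
  renameR (R *)     = renameR R *

  renameT : ∀ {n} → Term τ n → Term τ′ n
  renameT (var i)   = var i
  renameT (const c) = const (σ c)

  renameA : ∀ {n} → Atom τ n → Atom τ′ n
  renameA (t ≐ t′)      = renameT t ≐ renameT t′
  renameA (un u t)      = un u (renameT t)
  renameA (edge t f t′) = edge (renameT t) f (renameT t′)

  renameQ : ∀ {n} → QF τ n → QF τ′ n
  renameQ (atom a) = atom (renameA a)
  renameQ tt       = tt
  renameQ ff       = ff
  renameQ (¬' φ)   = ¬' renameQ φ
  renameQ (φ ∧' ψ) = renameQ φ ∧' renameQ ψ
  renameQ (φ ∨' ψ) = renameQ φ ∨' renameQ ψ
  renameQ (φ ⇒' ψ) = renameQ φ ⇒' renameQ ψ

  renameE : ∀ {n} → EdgeAtom τ n → EdgeAtom τ′ n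
  renameE (i ─[ f ]→ j) = i ─[ f ]→ j

  renameN : ∀ {n} → Nbhd τ n → Nbhd τ′ n
  renameN = map renameE

  module _ {n} {P Q : Fin (suc n) → Set} (P⇒Q : ∀ i → P i → Q i) where

    VarsT-rename : (t : Term τ n) → VarsT τ P t → VarsT τ′ Q (renameT t)
    VarsT-rename (var i)   = P⇒Q i
    VarsT-rename (const c) = id

    VarsA-rename : (a : Atom τ n) → VarsA τ P a → VarsA τ′ Q (renameA a)
    VarsA-rename (t ≐ t′)      = Product.map (VarsT-rename t) (VarsT-rename t′)
    VarsA-rename (un u t)      = VarsT-rename t
    VarsA-rename (edge t f t′) = Product.map (VarsT-rename t) (VarsT-rename t′)

    VarsQ-rename : (ψ : QF τ n) → VarsQ τ P ψ → VarsQ τ′ Q (renameQ ψ)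
    VarsQ-rename (atom a) = VarsA-rename a
    VarsQ-rename tt       = id
    VarsQ-rename ff       = id
    VarsQ-rename (¬' φ)   = VarsQ-rename φ
    VarsQ-rename (φ ∧' ψ) = Product.map (VarsQ-rename φ) (VarsQ-rename ψ)
    VarsQ-rename (φ ∨' ψ) = Product.map (VarsQ-rename φ) (VarsQ-rename ψ)
    VarsQ-rename (φ ⇒' ψ) = Product.map (VarsQ-rename φ) (VarsQ-rename ψ)

  renameP : Pattern τ → Pattern τ′
  renameP (mkPat n N ψ wf) =
    mkPat n (renameN N) (renameQ ψ) (VarsQ-rename (λ _ → Sum.map₁ AnyP.map⁺) ψ wf)

  renameRC : RC τ → RC τ′
  renameRC ([ c , R ] p) = [ σ c , renameR R ] renameP p

  mutual
    OnlyPos-rename : ∀ {n} (ψ : QF τ n) → OnlyPos τ ψ → OnlyPos τ′ (renameQ ψ)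
    OnlyPos-rename (atom a) = id
    OnlyPos-rename tt       = id
    OnlyPos-rename ff       = id
    OnlyPos-rename (¬' φ)   = OnlyNeg-rename φ
    OnlyPos-rename (φ ∧' ψ) = Product.map (OnlyPos-rename φ) (OnlyPos-rename ψ)
    OnlyPos-rename (φ ∨' ψ) = Product.map (OnlyPos-rename φ) (OnlyPos-rename ψ)
    OnlyPos-rename (φ ⇒' ψ) = Product.map (OnlyNeg-rename φ) (OnlyPos-rename ψ)

    OnlyNeg-rename : ∀ {n} (ψ : QF τ n) → OnlyNeg τ ψ → OnlyNeg τ′ (renameQ ψ)
    OnlyNeg-rename (atom a) ()
    OnlyNeg-rename tt       = id
    OnlyNeg-rename ff       = id
    OnlyNeg-rename (¬' φ)   = OnlyPos-rename φ
    OnlyNeg-rename (φ ∧' ψ) = Product.map (OnlyNeg-rename φ) (OnlyNeg-rename ψ)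
    OnlyNeg-rename (φ ∨' ψ) = Product.map (OnlyNeg-rename φ) (OnlyNeg-rename ψ)
    OnlyNeg-rename (φ ⇒' ψ) = Product.map (OnlyPos-rename φ) (OnlyNeg-rename ψ)

  Dist≤1-rename : ∀ {n} (N : Nbhd τ n) {i j} → Dist≤1 τ N i j → Dist≤1 τ′ (renameN N) i j
  Dist≤1-rename N = Sum.map₂ (Product.map₂ (Sum.map (∈-map⁺ renameE) (∈-map⁺ renameE)))

  Admissible-rename : (p : Pattern τ) → Admissible τ p → Admissible τ′ (renameP p)
  Admissible-rename (mkPat _ N _ _) (eqPat (k , i~k , k~j)) =
    eqPat (k , Dist≤1-rename N i~k , Dist≤1-rename N k~j)
  Admissible-rename (mkPat _ N _ _) (edgePat i~j) = edgePat (Dist≤1-rename N i~j)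
  Admissible-rename (mkPat _ _ ψ _) (negPat ψ⁻)   = negPat (OnlyNeg-rename ψ ψ⁻)

  ∈L-rename⁺ : ∀ {w R} → _∈L_ τ w R → _∈L_ τ′ (map renameL w) (renameR R)
  ∈L-rename⁺ ε∈    = ε∈
  ∈L-rename⁺ fwd∈  = fwd∈
  ∈L-rename⁺ bwd∈  = bwd∈
  ∈L-rename⁺ pos∈  = pos∈
  ∈L-rename⁺ neg∈  = neg∈
  ∈L-rename⁺ posc∈ = posc∈
  ∈L-rename⁺ negc∈ = negc∈
  ∈L-rename⁺ (·∈ {w₁ = w₁} {w₂} w₁∈ w₂∈)
    rewrite map-++ renameL w₁ w₂ = ·∈ (∈L-rename⁺ w₁∈) (∈L-rename⁺ w₂∈)
  ∈L-rename⁺ (∣∈₁ w∈) = ∣∈₁ (∈L-rename⁺ w∈)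
  ∈L-rename⁺ (∣∈₂ w∈) = ∣∈₂ (∈L-rename⁺ w∈)
  ∈L-rename⁺ *∈[]     = *∈[]
  ∈L-rename⁺ (*∈++ {w₁ = w₁} {w₂} w₁∈ w₂∈)
    rewrite map-++ renameL w₁ w₂ = *∈++ (∈L-rename⁺ w₁∈) (∈L-rename⁺ w₂∈)

  ∈L-rename⁻ : ∀ R {w} → _∈L_ τ′ w (renameR R) → ∃ λ w₀ → _∈L_ τ w₀ R × map renameL w₀ ≡ w
  ∈L-rename⁻ ε       ε∈    = _ , ε∈ , refl
  ∈L-rename⁻ (⟶ f)   fwd∈  = _ , fwd∈ , refl
  ∈L-rename⁻ (⟵ f)   bwd∈  = _ , bwd∈ , refl
  ∈L-rename⁻ (`u u)  pos∈  = _ , pos∈ , refl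
  ∈L-rename⁻ (`¬u u) neg∈  = _ , neg∈ , refl
  ∈L-rename⁻ (`c c)  posc∈ = _ , posc∈ , refl
  ∈L-rename⁻ (`¬c c) negc∈ = _ , negc∈ , refl
  ∈L-rename⁻ (R₁ · R₂) (·∈ w₁∈ w₂∈)
    with w₁ , w₁∈₀ , refl ← ∈L-rename⁻ R₁ w₁∈ | w₂ , w₂∈₀ , refl ← ∈L-rename⁻ R₂ w₂∈
    = w₁ ++ w₂ , ·∈ w₁∈₀ w₂∈₀ , map-++ renameL w₁ w₂
  ∈L-rename⁻ (R₁ ∣ R₂) (∣∈₁ w∈) = Product.map₂ (Product.map₁ ∣∈₁) (∈L-rename⁻ R₁ w∈)
  ∈L-rename⁻ (R₁ ∣ R₂) (∣∈₂ w∈) = Product.map₂ (Product.map₁ ∣∈₂) (∈L-rename⁻ R₂ w∈)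
  ∈L-rename⁻ (R *) *∈[] = _ , *∈[] , refl
  ∈L-rename⁻ (R *) (*∈++ w₁∈ w₂∈)
    with w₁ , w₁∈₀ , refl ← ∈L-rename⁻ R w₁∈ | w₂ , w₂∈₀ , refl ← ∈L-rename⁻ (R *) w₂∈
    = w₁ ++ w₂ , *∈++ w₁∈₀ w₂∈₀ , map-++ renameL w₁ w₂

  module _ (G : Graph τ) (C : Fin m → V G) (σ-resp : C ∘ σ ≗ CG G) where

    private
      G′ = G [CG≔ C ]

    Step-rename : ∀ l {a b} → Step G′ (renameL l) a b ≡ Step G l a b
    Step-rename (fwd f)  = refl
    Step-rename (bwd f)  = refl
    Step-rename (pos u)  = refl
    Step-rename (neg u)  = refl
    Step-rename (posc c) {a} {b} = cong (λ x → a ≡ b × a ≡ x) (σ-resp c)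
    Step-rename (negc c) {a} {b} = cong (λ x → a ≡ b × ¬ a ≡ x) (σ-resp c)

    PathW-rename : ∀ w {a b} → PathW G′ (map renameL w) a b ⇔ PathW G w a b
    PathW-rename []      = ⇔-refl
    PathW-rename (l ∷ w) = mk⇔
      (Product.map₂ (Product.map (subst id (Step-rename l)) (to (PathW-rename w))))
      (Product.map₂ (Product.map (subst id (sym (Step-rename l))) (from (PathW-rename w))))

    RPath-rename : ∀ R {a b} → RPath G′ (renameR R) a b ⇔ RPath G R a b
    RPath-rename R = mk⇔ forward backward
      where
        forward : ∀ {a b} → RPath G′ (renameR R) a b → RPath G R a b
        forward (w , w∈ , path) with w₀ , w₀∈ , refl ← ∈L-rename⁻ R w∈ =
          w₀ , w₀∈ , to (PathW-rename w₀) path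

        backward : ∀ {a b} → RPath G R a b → RPath G′ (renameR R) a b
        backward (w , w∈ , path) = map renameL w , ∈L-rename⁺ w∈ , from (PathW-rename w) path

    ⟦renameT⟧ : ∀ {n} (t : Term τ n) ρ → ⟦_⟧T G′ (renameT t) ρ ≡ ⟦_⟧T G t ρ
    ⟦renameT⟧ (var i)   ρ = refl
    ⟦renameT⟧ (const c) ρ = σ-resp c

    ⟦renameA⟧ : ∀ {n} (a : Atom τ n) ρ → ⟦_⟧A G′ (renameA a) ρ ≡ ⟦_⟧A G a ρ
    ⟦renameA⟧ (t ≐ t′)      ρ = cong₂ _≡_ (⟦renameT⟧ t ρ) (⟦renameT⟧ t′ ρ)
    ⟦renameA⟧ (un u t)      ρ = cong (UG G u) (⟦renameT⟧ t ρ)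
    ⟦renameA⟧ (edge t f t′) ρ = cong₂ (E G f) (⟦renameT⟧ t ρ) (⟦renameT⟧ t′ ρ)

    ⟦renameQ⟧ : ∀ {n} (ψ : QF τ n) ρ → ⟦_⟧Q G′ (renameQ ψ) ρ ≡ ⟦_⟧Q G ψ ρ
    ⟦renameQ⟧ (atom a) ρ = ⟦renameA⟧ a ρ
    ⟦renameQ⟧ tt       ρ = refl
    ⟦renameQ⟧ ff       ρ = refl
    ⟦renameQ⟧ (¬' φ)   ρ = cong ¬_ (⟦renameQ⟧ φ ρ)
    ⟦renameQ⟧ (φ ∧' ψ) ρ = cong₂ _×_ (⟦renameQ⟧ φ ρ) (⟦renameQ⟧ ψ ρ)
    ⟦renameQ⟧ (φ ∨' ψ) ρ = cong₂ _⊎_ (⟦renameQ⟧ φ ρ) (⟦renameQ⟧ ψ ρ)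
    ⟦renameQ⟧ (φ ⇒' ψ) ρ = cong₂ (λ A B → A → B) (⟦renameQ⟧ φ ρ) (⟦renameQ⟧ ψ ρ)

    RPath-rename-from : ∀ c R {b} → RPath G′ (renameR R) (C (σ c)) b ⇔ RPath G R (CG G c) b
    RPath-rename-from c R {b} =
      ⇔-trans (≡⇒⇔ (cong (λ a → RPath G′ (renameR R) a b) (σ-resp c))) (RPath-rename R)

    ⊨RC-rename : ∀ r → G′ ⊨RC renameRC r ⇔ G ⊨RC r
    ⊨RC-rename ([ c , R ] mkPat n N ψ wf) = mk⇔
      (λ ⊨′ ρ path nb →
         subst id (⟦renameQ⟧ ψ ρ) (⊨′ ρ (from (RPath-rename-from c R) path) (AllP.map⁺ nb)))
      (λ ⊨ ρ path nb →
         subst id (sym (⟦renameQ⟧ ψ ρ)) (⊨ ρ (to (RPath-rename-from c R) path) (AllP.map⁻ nb)))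

Disj : {A : Set} → (A → Set) → List (List A) → Set
Disj P = Any (All P)

_⊗_ : {A : Set} → List (List A) → List (List A) → List (List A)
_⊗_ = cartesianProductWith _++_

module _ {A : Set} {P : A → Set} where

  ⊗⁺ : ∀ {xss yss} → Disj P xss → Disj P yss → Disj P (xss ⊗ yss)
  ⊗⁺ = AnyP.cartesianProductWith⁺ _++_ AllP.++⁺

  ⊗⁻ : ∀ xss yss → Disj P (xss ⊗ yss) → Disj P xss × Disj P yss
  ⊗⁻ = AnyP.cartesianProductWith⁻ _++_ (λ {xs} → AllP.++⁻ xs)

Disj-map : {A B : Set} {P : B → Set} {Q : A → Set} {f : A → B} →
           (∀ {x} → P (f x) ⇔ Q x) → ∀ xss → Disj P (map (map f) xss) ⇔ Disj Q xss
Disj-map Pf⇔Q xss = mk⇔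
  (Any.map (All.map (to Pf⇔Q) ∘ AllP.map⁻) ∘ AnyP.map⁻)
  (AnyP.map⁺ ∘ Any.map (AllP.map⁺ ∘ All.map (from Pf⇔Q)))

module DNF {τ : Vocab} where

  Literal : ℕ → Set
  Literal n = Bool × Atom τ n

  dnf : ∀ {n} → Bool → QF τ n → List (List (Literal n))
  dnf b     (atom a) = ((b , a) ∷ []) ∷ []
  dnf true  tt       = [] ∷ []
  dnf false tt       = []
  dnf true  ff       = []
  dnf false ff       = [] ∷ []
  dnf true  (¬' φ)   = dnf false φ
  dnf false (¬' φ)   = dnf true φ
  dnf true  (φ ∧' ψ) = dnf true φ ⊗ dnf true ψ
  dnf false (φ ∧' ψ) = dnf false φ ++ dnf false ψ
  dnf true  (φ ∨' ψ) = dnf true φ ++ dnf true ψ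
  dnf false (φ ∨' ψ) = dnf false φ ⊗ dnf false ψ
  dnf true  (φ ⇒' ψ) = dnf false φ ++ dnf true ψ
  dnf false (φ ⇒' ψ) = dnf true φ ⊗ dnf false ψ

  module _ (G : Graph τ) {n} (ρ : Fin (suc n) → V G) where

    ⟦_⟧L : Literal n → Set
    ⟦ b , a ⟧L = Signed b (⟦_⟧A G a ρ)

    dnf-sound : ∀ b ψ → Disj ⟦_⟧L (dnf b ψ) → Signed b (⟦_⟧Q G ψ ρ)
    dnf-sound b     (atom a) (here (⟦l⟧ ∷ [])) = ⟦l⟧
    dnf-sound true  tt       _ = tt
    dnf-sound false ff       _ = λ ()
    dnf-sound true  (¬' φ)   d = dnf-sound false φ d
    dnf-sound false (¬' φ)   d = λ ¬φ → ¬φ (dnf-sound true φ d)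
    dnf-sound true  (φ ∧' ψ) d =
      Product.map (dnf-sound true φ) (dnf-sound true ψ) (⊗⁻ (dnf true φ) _ d)
    dnf-sound false (φ ∧' ψ) d with AnyP.++⁻ (dnf false φ) d
    ... | inj₁ dφ = λ (φ⁺ , _) → dnf-sound false φ dφ φ⁺
    ... | inj₂ dψ = λ (_ , ψ⁺) → dnf-sound false ψ dψ ψ⁺
    dnf-sound true  (φ ∨' ψ) d =
      Sum.map (dnf-sound true φ) (dnf-sound true ψ) (AnyP.++⁻ (dnf true φ) d)
    dnf-sound false (φ ∨' ψ) d with ⊗⁻ (dnf false φ) _ d
    ... | dφ , dψ = Sum.[ dnf-sound false φ dφ , dnf-sound false ψ dψ ]
    dnf-sound true  (φ ⇒' ψ) d with AnyP.++⁻ (dnf false φ) d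
    ... | inj₁ dφ = ⊥-elim ∘ dnf-sound false φ dφ
    ... | inj₂ dψ = λ _ → dnf-sound true ψ dψ
    dnf-sound false (φ ⇒' ψ) d with ⊗⁻ (dnf true φ) _ d
    ... | dφ , dψ = λ φ⇒ψ → dnf-sound false ψ dψ (φ⇒ψ (dnf-sound true φ dφ))

    module _ (em : ExcludedMiddle (Level.suc 0ℓ)) where
      open Classical em

      dnf-complete : ∀ b ψ → Signed b (⟦_⟧Q G ψ ρ) → Disj ⟦_⟧L (dnf b ψ)
      dnf-complete b     (atom a) ⟦a⟧ = here (⟦a⟧ ∷ [])
      dnf-complete true  tt       _  = here []
      dnf-complete false tt       ¬⊤ = ⊥-elim (¬⊤ tt)
      dnf-complete false ff       _  = here []
      dnf-complete true  (¬' φ)   ¬φ = dnf-complete false φ ¬φ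
      dnf-complete false (¬' φ)   ¬¬φ = dnf-complete true φ (dne ¬¬φ)
      dnf-complete true  (φ ∧' ψ) (φ⁺ , ψ⁺) = ⊗⁺ (dnf-complete true φ φ⁺) (dnf-complete true ψ ψ⁺)
      dnf-complete false (φ ∧' ψ) ¬φ∧ψ with ¬×⇒¬⊎¬ ¬φ∧ψ
      ... | inj₁ ¬φ = AnyP.++⁺ˡ (dnf-complete false φ ¬φ)
      ... | inj₂ ¬ψ = AnyP.++⁺ʳ (dnf false φ) (dnf-complete false ψ ¬ψ)
      dnf-complete true  (φ ∨' ψ) (inj₁ φ⁺) = AnyP.++⁺ˡ (dnf-complete true φ φ⁺)
      dnf-complete true  (φ ∨' ψ) (inj₂ ψ⁺) = AnyP.++⁺ʳ (dnf true φ) (dnf-complete true ψ ψ⁺)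
      dnf-complete false (φ ∨' ψ) ¬φ∨ψ =
        ⊗⁺ (dnf-complete false φ (¬φ∨ψ ∘ inj₁)) (dnf-complete false ψ (¬φ∨ψ ∘ inj₂))
      dnf-complete true  (φ ⇒' ψ) φ⇒ψ with em₀ {⟦_⟧Q G φ ρ}
      ... | yes φ⁺ = AnyP.++⁺ʳ (dnf false φ) (dnf-complete true ψ (φ⇒ψ φ⁺))
      ... | no ¬φ  = AnyP.++⁺ˡ (dnf-complete false φ ¬φ)
      dnf-complete false (φ ⇒' ψ) ¬φ⇒ψ with ¬→⇒×¬ ¬φ⇒ψ
      ... | φ⁺ , ¬ψ = ⊗⁺ (dnf-complete true φ φ⁺) (dnf-complete false ψ ¬ψ)

take-resp : ∀ {k₁ k₂} {A X : Set} (C : A → X) (slot : Fin (k₁ + k₂) → A)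
            (ν₁ : Fin k₁ → X) {ν₂ : Fin k₂ → X} →
            C ∘ slot ≗ ν₁ ++ᵛ ν₂ → C ∘ take k₁ slot ≗ ν₁
take-resp {k₂ = k₂} _ _ ν₁ {ν₂} resp j = trans (resp (j ↑ˡ k₂)) (lookup-++ˡ ν₁ ν₂ j)

drop-resp : ∀ {k₁ k₂} {A X : Set} (C : A → X) (slot : Fin (k₁ + k₂) → A)
            (ν₁ : Fin k₁ → X) {ν₂ : Fin k₂ → X} →
            C ∘ slot ≗ ν₁ ++ᵛ ν₂ → C ∘ drop k₁ slot ≗ ν₂
drop-resp {k₁} _ _ ν₁ {ν₂} resp j = trans (resp (k₁ ↑ʳ j)) (lookup-++ʳ ν₁ ν₂ j)

width : ∀ {τ} → LRP τ → ℕ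
width (rc ([ _ , _ ] p)) = suc (Pattern.n p)
width tt       = 0
width ff       = 0
width (¬' φ)   = width φ
width (φ ∧' ψ) = width φ + width ψ
width (φ ∨' ψ) = width φ + width ψ

-- Fresh constants of a constraint that needs no witness are interpreted as its own constant.
anchor : ∀ {τ} (φ : LRP τ) → Fin (width φ) → Fin (nC τ)
anchor (rc ([ c , _ ] _)) _ = c
anchor (¬' φ)   = anchor φ
anchor (φ ∧' ψ) = anchor φ ++ᵛ anchor ψ
anchor (φ ∨' ψ) = anchor φ ++ᵛ anchor ψ

module Translation {τ : Vocab} {m : ℕ} (ι : Fin (nC τ) → Fin m) where

  open Renaming {τ} ι
  open DNF {τ}

  private
    τ′ = τ [nC≔ m ]

  module _ {n} (slot : Fin (suc n) → Fin m) where

    constOf : Term τ n → Fin m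
    constOf (var i)   = slot i
    constOf (const c) = ι c

    ground : Atom τ n → Atom τ′ 0
    ground (t ≐ t′)      = const (constOf t) ≐ const (constOf t′)
    ground (un u t)      = un u (const (constOf t))
    ground (edge t f t′) = edge (const (constOf t)) f (const (constOf t′))

    ¬ground-closed : ∀ a → VarsQ τ′ (λ i → FreeIn τ′ i [] ⊎ i ≡ zero) (¬' atom (ground a))
    ¬ground-closed (_ ≐ _)      = tt , tt
    ¬ground-closed (un _ _)     = tt
    ¬ground-closed (edge _ _ _) = tt , tt

    -- The pattern of a negative literal has no variables, so the start [slot zero , ε] is immaterial.
    literalC : Literal n → NConj τ′
    literalC (true , t ≐ t′)      = ⟨ constOf t , ε ⟩ constOf t′
    literalC (true , un u t)      = ⟨ constOf t , `u u ⟩ constOf t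
    literalC (true , edge t f t′) = ⟨ constOf t , ⟶ f ⟩ constOf t′
    literalC (false , a) =
      box ([ slot zero , ε ] mkPat 0 [] (¬' atom (ground a)) (¬ground-closed a)) (negPat tt)

    edgeC : EdgeAtom τ n → NConj τ′
    edgeC (i ─[ f ]→ j) = literalC (true , edge (var i) f (var j))

    matchC : Fin (nC τ) → Routing τ → Nbhd τ n → NLRP² τ′
    matchC c R N = ⟨ ι c , renameR R ⟩ slot zero ∷ map edgeC N

    violation : Fin (nC τ) → Routing τ → Nbhd τ n → QF τ n → List (NLRP² τ′)
    violation c R N ψ = (matchC c R N ∷ []) ⊗ map (map literalC) (dnf false ψ)

  restrict : Graph τ′ → Graph τ
  restrict G = G [CG≔ CG G ∘ ι ]

  module _ (em : ExcludedMiddle (Level.suc 0ℓ)) (G : Graph τ) (C : Fin m → V G) (ι-resp : C ∘ ι ≗ CG G)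
           {n} {slot : Fin (suc n) → Fin m} {ρ : Fin (suc n) → V G} (slot-resp : C ∘ slot ≗ ρ) where

    private
      G′ = G [CG≔ C ]

    constOf-sem : ∀ t → C (constOf slot t) ≡ ⟦_⟧T G t ρ
    constOf-sem (var i)   = slot-resp i
    constOf-sem (const c) = ι-resp c

    ⟦ground⟧ : ∀ a ρ′ → ⟦_⟧A G′ (ground slot a) ρ′ ≡ ⟦_⟧A G a ρ
    ⟦ground⟧ (t ≐ t′)      _ = cong₂ _≡_ (constOf-sem t) (constOf-sem t′)
    ⟦ground⟧ (un u t)      _ = cong (UG G u) (constOf-sem t)
    ⟦ground⟧ (edge t f t′) _ = cong₂ (E G f) (constOf-sem t) (constOf-sem t′)

    literalC-sem : ∀ l → G′ ⊨C literalC slot l ⇔ ⟦_⟧L G ρ l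
    literalC-sem (true , t ≐ t′) = ⇔-trans (⊨⟨⟩⇔RPath em G′)
      (⇔-trans (RPath-ε G′) (≡⇒⇔ (cong₂ _≡_ (constOf-sem t) (constOf-sem t′))))
    literalC-sem (true , un u t) = ⇔-trans (⊨⟨⟩⇔RPath em G′)
      (⇔-trans (RPath-`u G′) (≡⇒⇔ (cong (UG G u) (constOf-sem t))))
    literalC-sem (true , edge t f t′) = ⇔-trans (⊨⟨⟩⇔RPath em G′)
      (⇔-trans (RPath-⟶ G′) (≡⇒⇔ (cong₂ (E G f) (constOf-sem t) (constOf-sem t′))))
    literalC-sem (false , a) = mk⇔
      (λ ⊨ ⟦a⟧ → ⊨ (λ _ → C (slot zero)) ([] , ε∈ , refl) [] (subst id (sym (⟦ground⟧ a _)) ⟦a⟧))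
      (λ ¬⟦a⟧ ρ′ _ _ → ¬⟦a⟧ ∘ subst id (⟦ground⟧ a ρ′))

    edgeC-sem : ∀ e → G′ ⊨C edgeC slot e ⇔ E G (EdgeAtom.lab e) (ρ (EdgeAtom.src e)) (ρ (EdgeAtom.tgt e))
    edgeC-sem (i ─[ f ]→ j) = literalC-sem (true , edge (var i) f (var j))

    pathC-sem : ∀ c R → G′ ⊨C (⟨ ι c , renameR R ⟩ slot zero) ⇔ RPath G R (CG G c) (ρ zero)
    pathC-sem c R = ⇔-trans (⊨⟨⟩⇔RPath em G′)
      (⇔-trans (≡⇒⇔ (cong (RPath G′ (renameR R) (C (ι c))) (slot-resp zero)))
               (RPath-rename-from G C ι-resp c R))

    violation-sem : ∀ c R N ψ → Disj (G′ ⊨C_) (violation slot c R N ψ) ⇔ Violation G c R N ψ ρ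
    violation-sem c R N ψ = mk⇔ forward backward
      where
        forward : Disj (G′ ⊨C_) (violation slot c R N ψ) → Violation G c R N ψ ρ
        forward d with match , literals ← ⊗⁻ (matchC slot c R N ∷ []) _ d
                  with path ∷ edges ← AnyP.singleton⁻ match =
          to (pathC-sem c R) path ,
          All.map (to (edgeC-sem _)) (AllP.map⁻ edges) ,
          dnf-sound G ρ false ψ (to (Disj-map (literalC-sem _) (dnf false ψ)) literals)

        backward : Violation G c R N ψ ρ → Disj (G′ ⊨C_) (violation slot c R N ψ)
        backward (path , nb , ¬ψ) =
          ⊗⁺ {xss = matchC slot c R N ∷ []}
             (here (from (pathC-sem c R) path ∷ AllP.map⁺ (All.map (from (edgeC-sem _)) nb)))
             (from (Disj-map (literalC-sem _) (dnf false ψ)) (dnf-complete G ρ em false ψ ¬ψ))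

  -- slot j is the constant reserved for the j-th witness variable of the constraints of φ (see width).
  translate : Bool → (φ : LRP τ) → AllAdm τ φ → (Fin (width φ) → Fin m) → List (NLRP² τ′)
  translate true (rc ([ c , R ] p)) adm _ =
    (box (renameRC ([ c , R ] p)) (Admissible-rename p adm) ∷ []) ∷ []
  translate false (rc ([ c , R ] mkPat _ N ψ _)) _ slot = violation slot c R N ψ
  translate true  tt       _ _ = [] ∷ []
  translate false tt       _ _ = []
  translate true  ff       _ _ = []
  translate false ff       _ _ = [] ∷ []
  translate true  (¬' φ)   adm slot = translate false φ adm slot
  translate false (¬' φ)   adm slot = translate true φ adm slot
  translate true  (φ ∧' ψ) (admφ , admψ) slot =
    translate true φ admφ (take _ slot) ⊗ translate true ψ admψ (drop _ slot)
  translate false (φ ∧' ψ) (admφ , admψ) slot =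
    translate false φ admφ (take _ slot) ++ translate false ψ admψ (drop _ slot)
  translate true  (φ ∨' ψ) (admφ , admψ) slot =
    translate true φ admφ (take _ slot) ++ translate true ψ admψ (drop _ slot)
  translate false (φ ∨' ψ) (admφ , admψ) slot =
    translate false φ admφ (take _ slot) ⊗ translate false ψ admψ (drop _ slot)

  module _ (em : ExcludedMiddle (Level.suc 0ℓ)) where
    open Classical em

    translate-sound : ∀ b φ adm slot (G : Graph τ′) →
                      Disj (G ⊨C_) (translate b φ adm slot) → Signed b (restrict G ⊨ φ)
    translate-sound true (rc ([ c , R ] p)) _ _ G (here (⊨r ∷ [])) =
      to (⊨RC-rename (restrict G) (CG G) (λ _ → refl) ([ c , R ] p)) ⊨r
    translate-sound false (rc ([ c , R ] mkPat _ N ψ wf)) _ slot G d =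
      violation⇒¬⊨RC (restrict G) N ψ wf
        (to (violation-sem em (restrict G) (CG G) (λ _ → refl) {slot = slot} (λ _ → refl) c R N ψ) d)
    translate-sound true  tt     _ _ _ _ = tt
    translate-sound false ff     _ _ _ _ = λ ()
    translate-sound true  (¬' φ) adm slot G d = translate-sound false φ adm slot G d
    translate-sound false (¬' φ) adm slot G d = λ ¬φ → ¬φ (translate-sound true φ adm slot G d)
    translate-sound true  (φ ∧' ψ) (admφ , admψ) slot G d
      with dφ , dψ ← ⊗⁻ (translate true φ admφ (take _ slot)) _ d =
      translate-sound true φ admφ (take _ slot) G dφ , translate-sound true ψ admψ (drop _ slot) G dψ
    translate-sound false (φ ∧' ψ) (admφ , admψ) slot G d
      with AnyP.++⁻ (translate false φ admφ (take _ slot)) d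
    ... | inj₁ dφ = λ (φ⁺ , _) → translate-sound false φ admφ (take _ slot) G dφ φ⁺
    ... | inj₂ dψ = λ (_ , ψ⁺) → translate-sound false ψ admψ (drop _ slot) G dψ ψ⁺
    translate-sound true  (φ ∨' ψ) (admφ , admψ) slot G d
      with AnyP.++⁻ (translate true φ admφ (take _ slot)) d
    ... | inj₁ dφ = inj₁ (translate-sound true φ admφ (take _ slot) G dφ)
    ... | inj₂ dψ = inj₂ (translate-sound true ψ admψ (drop _ slot) G dψ)
    translate-sound false (φ ∨' ψ) (admφ , admψ) slot G d
      with dφ , dψ ← ⊗⁻ (translate false φ admφ (take _ slot)) _ d =
      Sum.[ translate-sound false φ admφ (take _ slot) G dφ
          , translate-sound false ψ admψ (drop _ slot) G dψ ]

    Realises : (G : Graph τ) {k : ℕ} → ((Fin k → Fin m) → List (NLRP² τ′)) → (Fin k → V G) → Set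
    Realises G L ν = ∀ slot C → C ∘ ι ≗ CG G → C ∘ slot ≗ ν → Disj ((G [CG≔ C ]) ⊨C_) (L slot)

    module _ {G : Graph τ} {k₁ k₂ : ℕ} where

      realises-⊗ : ∀ {L₁ : (Fin k₁ → Fin m) → List (NLRP² τ′)} {L₂ : (Fin k₂ → Fin m) → List (NLRP² τ′)} →
                   ∃ (Realises G L₁) → ∃ (Realises G L₂) →
                   ∃ (Realises G (λ slot → L₁ (take k₁ slot) ⊗ L₂ (drop k₁ slot)))
      realises-⊗ (ν₁ , r₁) (ν₂ , r₂) = ν₁ ++ᵛ ν₂ , λ slot C ι-resp resp →
        ⊗⁺ (r₁ _ C ι-resp (take-resp C slot ν₁ resp)) (r₂ _ C ι-resp (drop-resp C slot ν₁ resp))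

      realises-++ˡ : ∀ {L₁ : (Fin k₁ → Fin m) → List (NLRP² τ′)} → ∃ (Realises G L₁) →
                     (L₂ : (Fin k₂ → Fin m) → List (NLRP² τ′)) → (Fin k₂ → V G) →
                     ∃ (Realises G (λ slot → L₁ (take k₁ slot) ++ L₂ (drop k₁ slot)))
      realises-++ˡ (ν₁ , r₁) _ ν₂ = ν₁ ++ᵛ ν₂ , λ slot C ι-resp resp →
        AnyP.++⁺ˡ (r₁ _ C ι-resp (take-resp C slot ν₁ resp))

      realises-++ʳ : (L₁ : (Fin k₁ → Fin m) → List (NLRP² τ′)) → (Fin k₁ → V G) →
                     ∀ {L₂ : (Fin k₂ → Fin m) → List (NLRP² τ′)} → ∃ (Realises G L₂) →
                     ∃ (Realises G (λ slot → L₁ (take k₁ slot) ++ L₂ (drop k₁ slot)))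
      realises-++ʳ L₁ ν₁ (ν₂ , r₂) = ν₁ ++ᵛ ν₂ , λ slot C ι-resp resp →
        AnyP.++⁺ʳ (L₁ _) (r₂ _ C ι-resp (drop-resp C slot ν₁ resp))

    translate-complete : ∀ b φ adm (G : Graph τ) → Signed b (G ⊨ φ) → ∃ (Realises G (translate b φ adm))
    translate-complete true (rc ([ c , R ] p)) _ G ⊨r =
      (λ _ → CG G c) , λ _ C ι-resp _ → here (from (⊨RC-rename G C ι-resp ([ c , R ] p)) ⊨r ∷ [])
    translate-complete false (rc ([ c , R ] mkPat _ N ψ wf)) _ G ¬⊨r
      with ρ , v ← ¬⊨RC⇒violation em G N ψ wf ¬⊨r =
      ρ , λ _ C ι-resp resp → from (violation-sem em G C ι-resp resp c R N ψ) v
    translate-complete true  tt _ _ _  = (λ ()) , λ _ _ _ _ → here []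
    translate-complete false tt _ _ ¬⊤ = ⊥-elim (¬⊤ tt)
    translate-complete false ff _ _ _  = (λ ()) , λ _ _ _ _ → here []
    translate-complete true  (¬' φ) adm G ¬φ  = translate-complete false φ adm G ¬φ
    translate-complete false (¬' φ) adm G ¬¬φ = translate-complete true φ adm G (dne ¬¬φ)
    translate-complete true  (φ ∧' ψ) (admφ , admψ) G (φ⁺ , ψ⁺) =
      realises-⊗ (translate-complete true φ admφ G φ⁺) (translate-complete true ψ admψ G ψ⁺)
    translate-complete false (φ ∧' ψ) (admφ , admψ) G ¬φ∧ψ with ¬×⇒¬⊎¬ ¬φ∧ψ
    ... | inj₁ ¬φ =
      realises-++ˡ (translate-complete false φ admφ G ¬φ) (translate false ψ admψ) (CG G ∘ anchor ψ)
    ... | inj₂ ¬ψ =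
      realises-++ʳ (translate false φ admφ) (CG G ∘ anchor φ) (translate-complete false ψ admψ G ¬ψ)
    translate-complete true  (φ ∨' ψ) (admφ , admψ) G (inj₁ φ⁺) =
      realises-++ˡ (translate-complete true φ admφ G φ⁺) (translate true ψ admψ) (CG G ∘ anchor ψ)
    translate-complete true  (φ ∨' ψ) (admφ , admψ) G (inj₂ ψ⁺) =
      realises-++ʳ (translate true φ admφ) (CG G ∘ anchor φ) (translate-complete true ψ admψ G ψ⁺)
    translate-complete false (φ ∨' ψ) (admφ , admψ) G ¬φ∨ψ =
      realises-⊗ (translate-complete false φ admφ G (¬φ∨ψ ∘ inj₁))
                 (translate-complete false ψ admψ G (¬φ∨ψ ∘ inj₂))

theorem3 : (τ : Vocab) →
    Σ (LRP² τ → Σ ℕ (λ k → List (NLRP² (extend τ k))))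
      (λ T → ExcludedMiddle (Level.suc 0ℓ) →
        (φ : LRP² τ) → SatLRP² φ ⇔ SatDisj (proj₂ (T φ)))
theorem3 τ = translation , λ em (φ , adm) → mk⇔ (complete em φ adm) (sound em φ adm)
  where
    open Translation {τ}

    translation : LRP² τ → Σ ℕ (λ k → List (NLRP² (extend τ k)))
    translation (φ , adm) = width φ , translate (_↑ˡ width φ) true φ adm (nC τ ↑ʳ_)

    sound : (em : ExcludedMiddle (Level.suc 0ℓ)) →
            ∀ φ adm → SatDisj (proj₂ (translation (φ , adm))) → SatLRP² (φ , adm)
    sound em φ adm (G , d) =
      restrict (_↑ˡ width φ) G , translate-sound (_↑ˡ width φ) em true φ adm (nC τ ↑ʳ_) G d

    complete : (em : ExcludedMiddle (Level.suc 0ℓ)) →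
               ∀ φ adm → SatLRP² (φ , adm) → SatDisj (proj₂ (translation (φ , adm)))
    complete em φ adm (G , ⊨φ) with ν , realises ← translate-complete (_↑ˡ width φ) em true φ adm G ⊨φ =
      G [CG≔ CG G ++ᵛ ν ] , realises (nC τ ↑ʳ_) (CG G ++ᵛ ν) (lookup-++ˡ (CG G) ν) (lookup-++ʳ (CG G) ν)
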